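{- For any nonnegative integers $n$ and $k$ with $n \ge 6k+4$, $$\Phi(n,k) := \Delta(n+1,k) - \Delta(n,k) > 0.$$
   Context: For integers $n \ge 1$ and $k \ge 0$, $JL_{n,k} = \sum_{i=k}^{\lfloor n/2 \rfloor} \frac{n}{n-i} \binom{n-i}{i} \binom{i}{k}$ (empty sum $=0$), and $\Delta(n,k) = JL_{n,k+1} - JL_{n,k}$. -}

module Defs where

open import Data.Nat as ℕ using (ℕ; zero; suc; _∸_; _≤_)
open import Data.Nat.Combinatorics using (_C_)
open import Data.Integer using (+_)
open import Data.Rational using (ℚ; 0ℚ; _/_; _+_; _-_)
open import Data.List using (List; map; foldr)
open import Data.Nat.Base using (_/_)

-- the rational number  a / b  (with a / 0 := 0, which never occurs below)
frac : ℕ → ℕ → ℚ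
frac a zero = 0ℚ
frac a (suc b) = Data.Rational._/_ (+ a) (suc b)

-- summation over i = lo, lo+1, ..., hi  (empty sum = 0 when hi < lo)
sumFromTo : ℕ → ℕ → (ℕ → ℚ) → ℚ
sumFromTo lo hi f = go (suc hi ∸ lo) lo
  where
  go : ℕ → ℕ → ℚ
  go zero i = 0ℚ
  go (suc m) i = f i + go m (suc i)

JL : ℕ → ℕ → ℚ
JL n k = sumFromTo k (n ℕ./ 2)
  (λ i → frac (n ℕ.* ((n ∸ i) C i) ℕ.* (i C k)) (n ∸ i))

Δ : ℕ → ℕ → ℚ
Δ n k = JL n (suc k) - JL n k

Φ : ℕ → ℕ → ℚ
Φ n k = Δ (suc n) k - Δ n k

-- With f_K = (1 - t - t²)^(-K), the generating function of JL(·, k) is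
-- (2 - t)·t^(2k)·f_(k+1), so JL(n, k) = 2·[t^(n-2k)] f_(k+1) - [t^(n-2k-1)] f_(k+1).
-- Write n = 2k + 4 + M and Dⱼ = [t^(M+j)] f_(k+1).  The relations
-- (1 - t - t²)·f_(K+1) = f_K and f_K′ = K(1 + 2t)·f_(K+1) turn (M + 5)(k + 1)·Φ(n, k)
-- into β·D₃ - α·D₄ for explicit quadratics α, β, so Φ > 0 amounts to D₄/D₃ < β/α.
-- For k = 0 the Dⱼ are Fibonacci numbers and β = 2α.  For k ≥ 1 the coefficients
-- of f_(k+1) are log-concave, which together with their three-term recurrence
-- bounds D₄/D₃ by the positive root of a quadratic; n ≥ 6k + 4, i.e. M ≥ 4k,
-- puts β/α beyond that root.
module Submission where

open import Defs

module FibonacciConvolution where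

  open import Data.Nat
  open import Data.Nat.Properties
  open import Data.List.Base using (_∷_; [])
  open import Relation.Binary.PropositionalEquality
  open import Data.Nat.Tactic.RingSolver using (solve)

  -- fibConv K i is the coefficient of tⁱ in (1 - t - t²)^(-K): the clauses say
  -- (1 - t - t²)·f_(K+1) = f_K.  For K = 1 these are the Fibonacci numbers.
  fibConv : ℕ → ℕ → ℕ
  fibConv zero    zero          = 1
  fibConv zero    (suc i)       = 0
  fibConv (suc K) zero          = 1
  fibConv (suc K) (suc zero)    = fibConv (suc K) zero + fibConv K 1
  fibConv (suc K) (suc (suc i)) = fibConv (suc K) (suc i) + fibConv (suc K) i + fibConv K (suc (suc i))

  fibConv-0 : ∀ K → fibConv K 0 ≡ 1
  fibConv-0 zero    = refl
  fibConv-0 (suc K) = refl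

  fibConv-1 : ∀ K → fibConv K 1 ≡ K
  fibConv-1 zero    = refl
  fibConv-1 (suc K) = cong suc (fibConv-1 K)

  fibConv-2 : ∀ K → 2 * fibConv K 2 ≡ K * (K + 3)
  fibConv-2 zero    = refl
  fibConv-2 (suc K) = step (fibConv-1 (suc K)) (fibConv-2 K)
    where
    open ≡-Reasoning
    step : ∀ {a c} → a ≡ suc K → 2 * c ≡ K * (K + 3) → 2 * (a + 1 + c) ≡ suc K * (suc K + 3)
    step {c = c} refl hc = begin
      2 * (suc K + 1 + c)            ≡⟨ solve (K ∷ c ∷ []) ⟩
      2 * (suc K + 1) + 2 * c        ≡⟨ cong (2 * (suc K + 1) +_) hc ⟩
      2 * (suc K + 1) + K * (K + 3)  ≡⟨ solve (K ∷ []) ⟩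
      suc K * (suc K + 3)            ∎

  fibConv-3 : ∀ K → 6 * fibConv K 3 ≡ K * (K + 1) * (K + 8)
  fibConv-3 zero    = refl
  fibConv-3 (suc K) = step (fibConv (suc K) 2) (fibConv-2 (suc K)) (fibConv-1 (suc K)) (fibConv-3 K)
    where
    open ≡-Reasoning
    step : ∀ a {b c} → 2 * a ≡ suc K * (suc K + 3) → b ≡ suc K → 6 * c ≡ K * (K + 1) * (K + 8) →
           6 * (a + b + c) ≡ suc K * (suc K + 1) * (suc K + 8)
    step a {c = c} ha refl hc = begin
      6 * (a + suc K + c)                    ≡⟨ solve (K ∷ a ∷ c ∷ []) ⟩
      3 * (2 * a) + 6 * suc K + 6 * c        ≡⟨ cong₂ (λ u v → 3 * u + 6 * suc K + v) ha hc ⟩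
      3 * (suc K * (suc K + 3)) + 6 * suc K + K * (K + 1) * (K + 8)
                                             ≡⟨ solve (K ∷ []) ⟩
      suc K * (suc K + 1) * (suc K + 8)      ∎

  fibConv-4 : ∀ K → 24 * fibConv K 4 ≡ K * (K + 1) * (K + 3) * (K + 14)
  fibConv-4 zero    = refl
  fibConv-4 (suc K) =
    step (fibConv (suc K) 3) (fibConv (suc K) 2) (fibConv K 4) (fibConv-3 (suc K)) (fibConv-2 (suc K)) (fibConv-4 K)
    where
    open ≡-Reasoning
    step : ∀ a b c → 6 * a ≡ suc K * (suc K + 1) * (suc K + 8) → 2 * b ≡ suc K * (suc K + 3) →
           24 * c ≡ K * (K + 1) * (K + 3) * (K + 14) →
           24 * (a + b + c) ≡ suc K * (suc K + 1) * (suc K + 3) * (suc K + 14)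
    step a b c ha hb hc = begin
      24 * (a + b + c)                       ≡⟨ solve (a ∷ b ∷ c ∷ []) ⟩
      4 * (6 * a) + 12 * (2 * b) + 24 * c    ≡⟨ cong₂ _+_ (cong₂ (λ u v → 4 * u + 12 * v) ha hb) hc ⟩
      4 * (suc K * (suc K + 1) * (suc K + 8)) + 12 * (suc K * (suc K + 3)) + K * (K + 1) * (K + 3) * (K + 14)
                                             ≡⟨ solve (K ∷ []) ⟩
      suc K * (suc K + 1) * (suc K + 3) * (suc K + 14) ∎

  -- The coefficientwise form of f_K′ = K (1 + 2t) f_(K+1).
  fibConv-derivative : ∀ K i → K * (fibConv (suc K) (suc i) + 2 * fibConv (suc K) i) ≡ (2 + i) * fibConv K (2 + i)
  fibConv-derivative zero    i             = sym (*-zeroʳ (2 + i))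
  fibConv-derivative (suc K) zero          = begin
    suc K * (fibConv (2 + K) 1 + 2 * 1)  ≡⟨ cong (λ a → suc K * (a + 2 * 1)) (fibConv-1 (2 + K)) ⟩
    suc K * (2 + K + 2 * 1)              ≡⟨ solve (K ∷ []) ⟩
    suc K * (suc K + 3)                  ≡⟨ fibConv-2 (suc K) ⟨
    2 * fibConv (suc K) 2                ∎
    where open ≡-Reasoning
  fibConv-derivative (suc K) (suc zero)    =
    *-cancelˡ-≡ _ _ 2 (base (fibConv (2 + K) 2) (fibConv (suc K) 3)
                            (fibConv-2 (2 + K)) (fibConv-1 (2 + K)) (fibConv-3 (suc K)))
    where
    open ≡-Reasoning
    base : ∀ a c {b} → 2 * a ≡ (2 + K) * (2 + K + 3) → b ≡ 2 + K → 6 * c ≡ suc K * (suc K + 1) * (suc K + 8) →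
           2 * (suc K * (a + 2 * b)) ≡ 2 * (3 * c)
    base a c ha refl hc = begin
      2 * (suc K * (a + 2 * (2 + K)))                          ≡⟨ solve (K ∷ a ∷ []) ⟩
      suc K * (2 * a) + 4 * suc K * (2 + K)                    ≡⟨ cong (λ u → suc K * u + 4 * suc K * (2 + K)) ha ⟩
      suc K * ((2 + K) * (2 + K + 3)) + 4 * suc K * (2 + K)    ≡⟨ solve (K ∷ []) ⟩
      suc K * (suc K + 1) * (suc K + 8)                        ≡⟨ hc ⟨
      6 * c                                                    ≡⟨ solve (c ∷ []) ⟩
      2 * (3 * c)                                              ∎
  fibConv-derivative (suc K) (suc (suc i)) =
    step (fibConv (2 + K) i) (fibConv (2 + K) (1 + i)) (fibConv (2 + K) (2 + i))
         (fibConv (suc K) (2 + i)) (fibConv (suc K) (3 + i)) (fibConv K (4 + i))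
         (fibConv-derivative (suc K) (suc i)) (fibConv-derivative (suc K) i) (fibConv-derivative K (2 + i))
    where
    open ≡-Reasoning
    step : ∀ a₀ a₁ a₂ d₂ d₃ c₄ →
           suc K * (a₂ + 2 * a₁) ≡ (3 + i) * d₃ → suc K * (a₁ + 2 * a₀) ≡ (2 + i) * d₂ →
           K * (d₃ + 2 * d₂) ≡ (4 + i) * c₄ →
           suc K * ((a₂ + a₁ + d₃) + 2 * (a₁ + a₀ + d₂)) ≡ (4 + i) * (d₃ + d₂ + c₄)
    step a₀ a₁ a₂ d₂ d₃ c₄ h₂ h₁ h = begin
      suc K * ((a₂ + a₁ + d₃) + 2 * (a₁ + a₀ + d₂))
        ≡⟨ solve (K ∷ a₀ ∷ a₁ ∷ a₂ ∷ d₂ ∷ d₃ ∷ []) ⟩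
      suc K * (a₂ + 2 * a₁) + suc K * (a₁ + 2 * a₀) + K * (d₃ + 2 * d₂) + (d₃ + 2 * d₂)
        ≡⟨ cong (_+ (d₃ + 2 * d₂)) (cong₂ _+_ (cong₂ _+_ h₂ h₁) h) ⟩
      (3 + i) * d₃ + (2 + i) * d₂ + (4 + i) * c₄ + (d₃ + 2 * d₂)
        ≡⟨ solve (i ∷ d₂ ∷ d₃ ∷ c₄ ∷ []) ⟩
      (4 + i) * (d₃ + d₂ + c₄) ∎

  fibConv-recurrence : ∀ K i →
    (2 + i) * fibConv K (2 + i) ≡ (1 + i + K) * fibConv K (1 + i) + (i + 2 * K) * fibConv K i
  fibConv-recurrence K i = trans (sym (fibConv-derivative K i)) (expand i)
    where
    open ≡-Reasoning
    expand : ∀ i → K * (fibConv (suc K) (suc i) + 2 * fibConv (suc K) i) ≡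
                   (1 + i + K) * fibConv K (1 + i) + (i + 2 * K) * fibConv K i
    expand zero = begin
      K * (1 + fibConv K 1 + 2 * 1)  ≡⟨ cong (λ b → K * (1 + b + 2 * 1)) (fibConv-1 K) ⟩
      K * (1 + K + 2 * 1)            ≡⟨ solve (K ∷ []) ⟩
      (1 + K) * K + 2 * K * 1        ≡⟨ cong₂ (λ b c → (1 + K) * b + 2 * K * c) (fibConv-1 K) (fibConv-0 K) ⟨
      (1 + K) * fibConv K 1 + 2 * K * fibConv K 0 ∎
    expand (suc zero) = base (fibConv K 2) (fibConv-1 K) (fibConv-2 K)
      where
      base : ∀ c {b} → b ≡ K → 2 * c ≡ K * (K + 3) →
             K * (1 + b + 1 + c + 2 * (1 + b)) ≡ (2 + K) * c + (1 + 2 * K) * b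
      base c refl hc = begin
        K * (1 + K + 1 + c + 2 * (1 + K))     ≡⟨ solve (K ∷ c ∷ []) ⟩
        K * (K + 3) + K * c + (2 * K * K + K) ≡⟨ cong (λ u → u + K * c + (2 * K * K + K)) hc ⟨
        2 * c + K * c + (2 * K * K + K)       ≡⟨ solve (K ∷ c ∷ []) ⟩
        (2 + K) * c + (1 + 2 * K) * K         ∎
    expand (suc (suc j)) =
      step (fibConv (suc K) j) (fibConv (suc K) (1 + j)) (fibConv K (2 + j)) (fibConv K (3 + j))
           (fibConv-derivative K (1 + j)) (fibConv-derivative K j)
      where
      step : ∀ a₀ a₁ d₂ d₃ →
             K * ((a₁ + a₀ + d₂) + 2 * a₁) ≡ (3 + j) * d₃ → K * (a₁ + 2 * a₀) ≡ (2 + j) * d₂ →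
             K * (((a₁ + a₀ + d₂) + a₁ + d₃) + 2 * (a₁ + a₀ + d₂)) ≡ (3 + j + K) * d₃ + (2 + j + 2 * K) * d₂
      step a₀ a₁ d₂ d₃ h₁ h₀ = begin
        K * (((a₁ + a₀ + d₂) + a₁ + d₃) + 2 * (a₁ + a₀ + d₂))
          ≡⟨ solve (K ∷ a₀ ∷ a₁ ∷ d₂ ∷ d₃ ∷ []) ⟩
        K * ((a₁ + a₀ + d₂) + 2 * a₁) + K * (a₁ + 2 * a₀) + (K * d₃ + 2 * K * d₂)
          ≡⟨ cong (_+ (K * d₃ + 2 * K * d₂)) (cong₂ _+_ h₁ h₀) ⟩
        (3 + j) * d₃ + (2 + j) * d₂ + (K * d₃ + 2 * K * d₂)
          ≡⟨ solve (K ∷ j ∷ d₂ ∷ d₃ ∷ []) ⟩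
        (3 + j + K) * d₃ + (2 + j + 2 * K) * d₂ ∎

  fibConv-positive : ∀ K i → 0 < fibConv (suc K) i
  fibConv-positive K zero          = z<s
  fibConv-positive K (suc zero)    = z<s
  fibConv-positive K (suc (suc i)) =
    <-≤-trans (fibConv-positive K (suc i)) (≤-trans (m≤m+n _ _) (m≤m+n _ _))

  fibonacci-<-double : ∀ i → fibConv 1 (3 + i) < 2 * fibConv 1 (2 + i)
  fibonacci-<-double i = begin-strict
    fibConv 1 (2 + i) + fibConv 1 (1 + i) + 0  ≡⟨ +-identityʳ _ ⟩
    fibConv 1 (2 + i) + fibConv 1 (1 + i)      <⟨ +-monoʳ-< (fibConv 1 (2 + i)) growing ⟩
    fibConv 1 (2 + i) + fibConv 1 (2 + i)      ≡⟨ cong (fibConv 1 (2 + i) +_) (+-identityʳ _) ⟨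
    2 * fibConv 1 (2 + i)                      ∎
    where
    open ≤-Reasoning
    growing : fibConv 1 (1 + i) < fibConv 1 (2 + i)
    growing = ≤-trans (m<m+n _ (fibConv-positive 0 i)) (m≤m+n _ 0)

  -- (5 + m)W² - (4 + m)VX = μ(3 + m)(y² - zx) + P, where P has nonnegative
  -- coefficients.
  logConcave-certificate : ∀ k m y z X W V → let K = 2 + k in
    X ≡ (2 + m + K) * y + (1 + m + 2 * K) * z →
    W ≡ (3 + m + K) * X + (2 + m + 2 * K) * (3 + m) * y →
    V ≡ (4 + m + K) * W + (3 + m + 2 * K) * (4 + m) * X →
    X * z ≤ (3 + m) * (y * y) → (4 + m) * V * X ≤ (5 + m) * (W * W)
  logConcave-certificate k m y z _ _ _ refl refl refl Xz≤ =
    let K = 2 + k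
        X = (2 + m + K) * y + (1 + m + 2 * K) * z
        W = (3 + m + K) * X + (2 + m + 2 * K) * (3 + m) * y
        V = (4 + m + K) * W + (3 + m + 2 * K) * (4 + m) * X
        μ = 535 + 462 * m + 146 * m * m + 20 * m * m * m + m * m * m * m + 344 * k + 243 * k * m
            + 55 * k * m * m + 4 * k * m * m * m + 47 * k * k + 29 * k * k * m + 4 * k * k * m * m
        P = (175 + 155 * m + 44 * m * m + 4 * m * m * m + 300 * k + 227 * k * m + 54 * k * m * m
             + 4 * k * m * m * m + 148 * k * k + 79 * k * k * m + 10 * k * k * m * m + 18 * k * k * k
             + 5 * k * k * k * m + k * k * k * k) * y * y
            + (200 + 155 * m + 38 * m * m + 3 * m * m * m + 345 * k + 234 * k * m + 48 * k * m * m
               + 3 * k * m * m * m + 176 * k * k + 88 * k * k * m + 10 * k * k * m * m + 41 * k * k * k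
               + 11 * k * k * k * m + 4 * k * k * k * k) * y * z
            + (10 * k * k * k + 2 * k * k * k * m + 4 * k * k * k * k) * z * z
    in +-cancelʳ-≤ (μ * ((3 + m) * (y * y))) _ _ (begin
      (4 + m) * V * X + μ * ((3 + m) * (y * y))      ≤⟨ m≤m+n _ P ⟩
      (4 + m) * V * X + μ * ((3 + m) * (y * y)) + P  ≡⟨ solve (k ∷ m ∷ y ∷ z ∷ []) ⟩
      (5 + m) * (W * W) + μ * (X * z)                ≤⟨ +-monoʳ-≤ ((5 + m) * (W * W)) (*-monoʳ-≤ μ Xz≤) ⟩
      (5 + m) * (W * W) + μ * ((3 + m) * (y * y))    ∎)
    where open ≤-Reasoning

  logConcave-step : ∀ k m z y x w v → let K = 2 + k in
    (3 + m) * x ≡ (2 + m + K) * y + (1 + m + 2 * K) * z →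
    (4 + m) * w ≡ (3 + m + K) * x + (2 + m + 2 * K) * y →
    (5 + m) * v ≡ (4 + m + K) * w + (3 + m + 2 * K) * x →
    z * x ≤ y * y → x * v ≤ w * w
  logConcave-step k m z y x w v hx hw hv zx≤yy =
    *-cancelˡ-≤ ((5 + m) * ((4 + m) * (3 + m)) * ((4 + m) * (3 + m))) (begin
      (5 + m) * ((4 + m) * (3 + m)) * ((4 + m) * (3 + m)) * (x * v)  ≡⟨ solve (m ∷ x ∷ v ∷ []) ⟩
      (4 + m) * ((5 + m) * (4 + m) * (3 + m) * v) * ((3 + m) * x)
        ≤⟨ logConcave-certificate k m y z X W V hx W≡ V≡ Xz≤ ⟩
      (5 + m) * ((4 + m) * (3 + m) * w * ((4 + m) * (3 + m) * w))    ≡⟨ solve (m ∷ w ∷ []) ⟩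
      (5 + m) * ((4 + m) * (3 + m)) * ((4 + m) * (3 + m)) * (w * w)  ∎)
    where
    open ≤-Reasoning
    X = (3 + m) * x
    W = (4 + m) * (3 + m) * w
    V = (5 + m) * (4 + m) * (3 + m) * v

    W≡ : W ≡ (3 + m + (2 + k)) * X + (2 + m + 2 * (2 + k)) * (3 + m) * y
    W≡ = begin-equality
      (4 + m) * (3 + m) * w                                          ≡⟨ solve (m ∷ w ∷ []) ⟩
      (3 + m) * ((4 + m) * w)                                        ≡⟨ cong ((3 + m) *_) hw ⟩
      (3 + m) * ((3 + m + (2 + k)) * x + (2 + m + 2 * (2 + k)) * y)  ≡⟨ solve (k ∷ m ∷ x ∷ y ∷ []) ⟩
      (3 + m + (2 + k)) * ((3 + m) * x) + (2 + m + 2 * (2 + k)) * (3 + m) * y ∎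

    V≡ : V ≡ (4 + m + (2 + k)) * W + (3 + m + 2 * (2 + k)) * (4 + m) * X
    V≡ = begin-equality
      (5 + m) * (4 + m) * (3 + m) * v                                ≡⟨ solve (m ∷ v ∷ []) ⟩
      (4 + m) * (3 + m) * ((5 + m) * v)                              ≡⟨ cong ((4 + m) * (3 + m) *_) hv ⟩
      (4 + m) * (3 + m) * ((4 + m + (2 + k)) * w + (3 + m + 2 * (2 + k)) * x)
                                                                     ≡⟨ solve (k ∷ m ∷ x ∷ w ∷ []) ⟩
      (4 + m + (2 + k)) * ((4 + m) * (3 + m) * w) + (3 + m + 2 * (2 + k)) * (4 + m) * ((3 + m) * x) ∎

    Xz≤ : X * z ≤ (3 + m) * (y * y)
    Xz≤ = begin
      (3 + m) * x * z      ≡⟨ solve (m ∷ x ∷ z ∷ []) ⟩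
      (3 + m) * (z * x)    ≤⟨ *-monoʳ-≤ (3 + m) zx≤yy ⟩
      (3 + m) * (y * y)    ∎

  fibConv-logConcave₀ : ∀ K → fibConv K 1 * fibConv K 3 ≤ fibConv K 2 * fibConv K 2
  fibConv-logConcave₀ K = base (fibConv K 2) (fibConv K 3) (fibConv-1 K) (fibConv-2 K) (fibConv-3 K)
    where
    open ≤-Reasoning
    base : ∀ c d {b} → b ≡ K → 2 * c ≡ K * (K + 3) → 6 * d ≡ K * (K + 1) * (K + 8) → b * d ≤ c * c
    base c d refl hc hd = *-cancelˡ-≤ 36 (begin
      36 * (K * d)                                                ≡⟨ solve (K ∷ d ∷ []) ⟩
      6 * K * (6 * d)                                             ≡⟨ cong (6 * K *_) hd ⟩
      6 * K * (K * (K + 1) * (K + 8))                             ≤⟨ m≤m+n _ _ ⟩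
      6 * K * (K * (K + 1) * (K + 8)) + 3 * K * K * (K * K + 11)  ≡⟨ solve (K ∷ []) ⟩
      9 * (K * (K + 3)) * (K * (K + 3))                           ≡⟨ cong (λ u → 9 * u * u) hc ⟨
      9 * (2 * c) * (2 * c)                                       ≡⟨ solve (c ∷ []) ⟩
      36 * (c * c)                                                ∎)

  fibConv-logConcave₁ : ∀ k → fibConv (2 + k) 2 * fibConv (2 + k) 4 ≤ fibConv (2 + k) 3 * fibConv (2 + k) 3
  fibConv-logConcave₁ k =
    base (fibConv (2 + k) 2) (fibConv (2 + k) 3) (fibConv (2 + k) 4)
         (fibConv-2 (2 + k)) (fibConv-3 (2 + k)) (fibConv-4 (2 + k))
    where
    open ≤-Reasoning
    base : ∀ c d e → let K = 2 + k in
           2 * c ≡ K * (K + 3) → 6 * d ≡ K * (K + 1) * (K + 8) → 24 * e ≡ K * (K + 1) * (K + 3) * (K + 14) →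
           c * e ≤ d * d
    base c d e hc hd he = let K = 2 + k in *-cancelˡ-≤ 576 (begin
      576 * (c * e)                                             ≡⟨ solve (c ∷ e ∷ []) ⟩
      12 * (2 * c) * (24 * e)                                   ≡⟨ cong₂ (λ u v → 12 * u * v) hc he ⟩
      12 * (K * (K + 3)) * (K * (K + 1) * (K + 3) * (K + 14))   ≤⟨ m≤m+n _ _ ⟩
      12 * (K * (K + 3)) * (K * (K + 1) * (K + 3) * (K + 14))
        + 4 * K * K * (K + 1) * (k * (k * k + 14 * k + 85))     ≡⟨ solve (k ∷ []) ⟩
      16 * (K * (K + 1) * (K + 8)) * (K * (K + 1) * (K + 8))    ≡⟨ cong (λ u → 16 * u * u) hd ⟨
      16 * (6 * d) * (6 * d)                                    ≡⟨ solve (d ∷ []) ⟩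
      576 * (d * d)                                             ∎)

  -- False for K = 1 (Cassini's identity), hence the index 2 + k.
  fibConv-logConcave : ∀ k i →
    fibConv (2 + k) (1 + i) * fibConv (2 + k) (3 + i) ≤ fibConv (2 + k) (2 + i) * fibConv (2 + k) (2 + i)
  fibConv-logConcave k zero          = fibConv-logConcave₀ (2 + k)
  fibConv-logConcave k (suc zero)    = fibConv-logConcave₁ k
  fibConv-logConcave k (suc (suc i)) =
    logConcave-step k i (e (1 + i)) (e (2 + i)) (e (3 + i)) (e (4 + i)) (e (5 + i))
      (fibConv-recurrence K (1 + i)) (fibConv-recurrence K (2 + i)) (fibConv-recurrence K (3 + i))
      (fibConv-logConcave k i)
    where
    K = 2 + k
    e = fibConv K

  logConcave⇒quadratic : ∀ c a b x y z → c * x ≡ a * y + b * z → z * x ≤ y * y →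
                          c * (x * x) ≤ a * (x * y) + b * (y * y)
  logConcave⇒quadratic c a b x y z cx≡ zx≤yy = begin
    c * (x * x)                ≡⟨ solve (c ∷ x ∷ []) ⟩
    x * (c * x)                ≡⟨ cong (x *_) cx≡ ⟩
    x * (a * y + b * z)        ≡⟨ solve (a ∷ b ∷ x ∷ y ∷ z ∷ []) ⟩
    a * (x * y) + b * (z * x)  ≤⟨ +-monoʳ-≤ (a * (x * y)) (*-monoʳ-≤ b zx≤yy) ⟩
    a * (x * y) + b * (y * y)  ∎
    where open ≤-Reasoning

  fibConv-quadratic : ∀ k i → let x = fibConv (2 + k) (3 + i) ; y = fibConv (2 + k) (2 + i) in
    (3 + i) * (x * x) ≤ (3 + i + suc k) * (x * y) + (3 + i + 2 * suc k) * (y * y)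
  fibConv-quadratic k i =
    logConcave⇒quadratic (3 + i) (3 + i + suc k) (3 + i + 2 * suc k) (e (3 + i)) (e (2 + i)) (e (1 + i))
      (trans (fibConv-recurrence (2 + k) (1 + i)) (cong₂ (λ a b → a * e (2 + i) + b * e (1 + i)) p≡ q≡))
      (fibConv-logConcave k i)
    where
    e = fibConv (2 + k)
    p≡ : 1 + (1 + i) + (2 + k) ≡ 3 + i + suc k
    p≡ = solve (i ∷ k ∷ [])
    q≡ : (1 + i) + 2 * (2 + k) ≡ 3 + i + 2 * suc k
    q≡ = solve (i ∷ k ∷ [])

module LucasSums where

  open import Function.Base using (_∘_)
  open import Data.Sum using (inj₁; inj₂)
  open import Data.Empty using (⊥-elim)
  open import Data.Nat
  open import Data.Nat.Properties
  open import Data.Nat.DivMod using (_/_; m*n/n≡m; /-monoˡ-≤)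
  open import Data.Nat.Combinatorics using (_C_; nCk+nC[k+1]≡[n+1]C[k+1]; nC1≡n; k>n⇒nCk≡0)
  open import Data.List.Base using (_∷_; [])
  open import Data.Nat.Tactic.RingSolver using (solve; solve-∀)
  open import Algebra.Properties.CommutativeSemigroup +-commutativeSemigroup
    using () renaming (interchange to +-interchange)
  open import Relation.Binary.PropositionalEquality
  open ≡-Reasoning

  open FibonacciConvolution using (fibConv)

  pascal : ∀ n k → suc n C suc k ≡ n C k + n C suc k
  pascal n k = sym (nCk+nC[k+1]≡[n+1]C[k+1] n k)

  absorption : ∀ n k → suc n * (n C k) ≡ suc k * (suc n C suc k)
  absorption zero    zero    = refl
  absorption zero    (suc k) = sym (*-zeroʳ (2 + k))
  absorption (suc n) zero    = trans (*-identityʳ (2 + n)) (sym (trans (+-identityʳ _) (nC1≡n (2 + n))))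
  absorption (suc n) (suc k) =
    step (n C k) (n C suc k) (suc n C suc (suc k)) (pascal n k) (pascal (suc n) (suc k))
         (absorption n k) (absorption n (suc k))
    where
    step : ∀ x y w {s t} → s ≡ x + y → t ≡ s + w →
           suc n * x ≡ suc k * s → suc n * y ≡ suc (suc k) * w → suc (suc n) * s ≡ suc (suc k) * t
    step x y w refl refl hx hy = begin
      suc (suc n) * (x + y)                        ≡⟨ solve (n ∷ x ∷ y ∷ []) ⟩
      suc n * x + suc n * y + (x + y)              ≡⟨ cong (_+ (x + y)) (cong₂ _+_ hx hy) ⟩
      suc k * (x + y) + suc (suc k) * w + (x + y)  ≡⟨ solve (k ∷ x ∷ y ∷ w ∷ []) ⟩
      suc (suc k) * (x + y + w)                    ∎

  sumFrom : ℕ → ℕ → (ℕ → ℕ) → ℕ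
  sumFrom i zero    h = 0
  sumFrom i (suc c) h = h i + sumFrom (suc i) c h

  sumFrom-cong : ∀ i c {g h : ℕ → ℕ} → (∀ t → g t ≡ h t) → sumFrom i c g ≡ sumFrom i c h
  sumFrom-cong i zero    g≡h = refl
  sumFrom-cong i (suc c) g≡h = cong₂ _+_ (g≡h i) (sumFrom-cong (suc i) c g≡h)

  sumFrom-+ : ∀ i c (g h : ℕ → ℕ) → sumFrom i c (λ t → g t + h t) ≡ sumFrom i c g + sumFrom i c h
  sumFrom-+ i zero    g h = refl
  sumFrom-+ i (suc c) g h = trans (cong (g i + h i +_) (sumFrom-+ (suc i) c g h))
                                  (+-interchange (g i) (h i) (sumFrom (suc i) c g) (sumFrom (suc i) c h))

  sumFrom-shift : ∀ i c h → sumFrom (suc i) c h ≡ sumFrom i c (h ∘ suc)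
  sumFrom-shift i zero    h = refl
  sumFrom-shift i (suc c) h = cong (h (suc i) +_) (sumFrom-shift (suc i) c h)

  sumFrom-snoc : ∀ i c h → sumFrom i (suc c) h ≡ sumFrom i c h + h (c + i)
  sumFrom-snoc i zero    h = +-identityʳ (h i)
  sumFrom-snoc i (suc c) h = begin
    h i + sumFrom (suc i) (suc c) h                 ≡⟨ cong (h i +_) (sumFrom-snoc (suc i) c h) ⟩
    h i + (sumFrom (suc i) c h + h (c + suc i))     ≡⟨ +-assoc (h i) _ _ ⟨
    h i + sumFrom (suc i) c h + h (c + suc i)       ≡⟨ cong (λ j → h i + sumFrom (suc i) c h + h j) (+-suc c i) ⟩
    h i + sumFrom (suc i) c h + h (suc c + i)       ∎

  sumFrom-split : ∀ i a b h → sumFrom i (a + b) h ≡ sumFrom i a h + sumFrom (i + a) b h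
  sumFrom-split i zero    b h = cong (λ j → sumFrom j b h) (sym (+-identityʳ i))
  sumFrom-split i (suc a) b h = begin
    h i + sumFrom (suc i) (a + b) h                         ≡⟨ cong (h i +_) (sumFrom-split (suc i) a b h) ⟩
    h i + (sumFrom (suc i) a h + sumFrom (suc i + a) b h)   ≡⟨ +-assoc (h i) _ _ ⟨
    h i + sumFrom (suc i) a h + sumFrom (suc i + a) b h
      ≡⟨ cong (λ j → h i + sumFrom (suc i) a h + sumFrom j b h) (+-suc i a) ⟨
    h i + sumFrom (suc i) a h + sumFrom (i + suc a) b h     ∎

  sumFrom-vanish : ∀ i c h → (∀ t → i ≤ t → h t ≡ 0) → sumFrom i c h ≡ 0
  sumFrom-vanish i zero    h _   = refl
  sumFrom-vanish i (suc c) h h≡0 =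
    cong₂ _+_ (h≡0 i ≤-refl) (sumFrom-vanish (suc i) c h λ t i<t → h≡0 t (<⇒≤ i<t))

  sumFrom-extend : ∀ lo hi N h → hi < N → (∀ t → t < lo → h t ≡ 0) → (∀ t → hi < t → h t ≡ 0) →
                   sumFrom lo (suc hi ∸ lo) h ≡ sumFrom 0 N h
  sumFrom-extend zero     hi N h hi<N _     above = begin
    sumFrom 0 (suc hi) h                                     ≡⟨ +-identityʳ _ ⟨
    sumFrom 0 (suc hi) h + 0
      ≡⟨ cong (sumFrom 0 (suc hi) h +_) (sumFrom-vanish (suc hi) (N ∸ suc hi) h above) ⟨
    sumFrom 0 (suc hi) h + sumFrom (suc hi) (N ∸ suc hi) h   ≡⟨ sumFrom-split 0 (suc hi) (N ∸ suc hi) h ⟨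
    sumFrom 0 (suc hi + (N ∸ suc hi)) h                      ≡⟨ cong (λ c → sumFrom 0 c h) (m+[n∸m]≡n hi<N) ⟩
    sumFrom 0 N h                                            ∎
  sumFrom-extend (suc lo) hi N h hi<N below above =
    trans drop-first (sumFrom-extend lo hi N h hi<N (λ t t<lo → below t (m<n⇒m<1+n t<lo)) above)
    where
    drop-first : sumFrom (suc lo) (hi ∸ lo) h ≡ sumFrom lo (suc hi ∸ lo) h
    drop-first with ≤-<-connex lo hi
    ... | inj₁ lo≤hi = begin
      sumFrom (suc lo) (hi ∸ lo) h               ≡⟨ cong (_+ sumFrom (suc lo) (hi ∸ lo) h) (below lo ≤-refl) ⟨
      h lo + sumFrom (suc lo) (hi ∸ lo) h        ≡⟨ cong (λ c → sumFrom lo c h) (+-∸-assoc 1 lo≤hi) ⟨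
      sumFrom lo (suc hi ∸ lo) h                 ∎
    ... | inj₂ hi<lo rewrite m≤n⇒m∸n≡0 (<⇒≤ hi<lo) | m≤n⇒m∸n≡0 hi<lo = refl

  diagonal : ℕ → ℕ → ℕ → ℕ
  diagonal zero    j k = (0 C j) * (j C k)
  diagonal (suc a) j k = (suc a C j) * (j C k) + diagonal a (suc j) k

  diagonal-sum : ∀ a j k → diagonal a j k ≡ sumFrom j (suc a) (λ t → ((j + a ∸ t) C t) * (t C k))
  diagonal-sum zero    j k =
    trans (sym (+-identityʳ _)) (cong (λ x → (x C j) * (j C k) + 0) (sym (m+n∸m≡n j 0)))
  diagonal-sum (suc a) j k = cong₂ _+_
    (cong (λ x → (x C j) * (j C k)) (sym (m+n∸m≡n j (suc a))))
    (trans (diagonal-sum a (suc j) k)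
           (sumFrom-cong (suc j) (suc a) λ t → cong (λ x → ((x ∸ t) C t) * (t C k)) (sym (+-suc j a))))

  diagonal-pascal : ∀ a j k →
    diagonal (suc a) (suc j) (suc k) ≡ diagonal a (suc j) (suc k) + diagonal a j (suc k) + diagonal a j k
  diagonal-pascal zero    j k = begin
    (1 C suc j) * (suc j C suc k) + 0              ≡⟨ cong₂ (λ u v → u * v + 0) (pascal 0 j) (pascal j k) ⟩
    (0 C j + 0) * (j C k + j C suc k) + 0          ≡⟨ distribute (0 C j) (j C k) (j C suc k) ⟩
    0 + (0 C j) * (j C suc k) + (0 C j) * (j C k)  ∎
    where
    distribute : ∀ z p q → (z + 0) * (p + q) + 0 ≡ 0 + z * q + z * p
    distribute = solve-∀
  diagonal-pascal (suc a) j k = begin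
      (suc (suc a) C suc j) * (suc j C suc k) + diagonal (suc a) (2 + j) (suc k)
    ≡⟨ cong₂ (λ u v → u * (suc j C suc k) + v) (pascal (suc a) j) (diagonal-pascal a (suc j) k) ⟩
      (suc a C j + suc a C suc j) * (suc j C suc k)
        + (diagonal a (2 + j) (suc k) + diagonal a (suc j) (suc k) + diagonal a (suc j) k)
    ≡⟨ regroup (suc a C j) (suc a C suc j) (j C k) (j C suc k) _ _ _ (pascal j k) ⟩
      ((suc a C suc j) * (suc j C suc k) + diagonal a (2 + j) (suc k))
        + ((suc a C j) * (j C suc k) + diagonal a (suc j) (suc k))
        + ((suc a C j) * (j C k) + diagonal a (suc j) k)
    ∎
    where
    regroup : ∀ x y p q u v w {Q} → Q ≡ p + q →
              (x + y) * Q + (u + v + w) ≡ (y * Q + u) + (x * q + v) + (x * p + w)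
    regroup x y p q u v w refl = solve (x ∷ y ∷ p ∷ q ∷ u ∷ v ∷ w ∷ [])

  diagonal-pascal₀ : ∀ a j → diagonal (suc a) (suc j) 0 ≡ diagonal a (suc j) 0 + diagonal a j 0
  diagonal-pascal₀ zero    j = trans (cong (λ u → u * 1 + 0) (pascal 0 j)) (drop (0 C j))
    where
    drop : ∀ z → (z + 0) * 1 + 0 ≡ z * 1
    drop = solve-∀
  diagonal-pascal₀ (suc a) j = begin
      (suc (suc a) C suc j) * 1 + diagonal (suc a) (2 + j) 0
    ≡⟨ cong₂ (λ u v → u * 1 + v) (pascal (suc a) j) (diagonal-pascal₀ a (suc j)) ⟩
      (suc a C j + suc a C suc j) * 1 + (diagonal a (2 + j) 0 + diagonal a (suc j) 0)
    ≡⟨ regroup (suc a C j) (suc a C suc j) _ _ ⟩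
      ((suc a C suc j) * 1 + diagonal a (2 + j) 0) + ((suc a C j) * 1 + diagonal a (suc j) 0)
    ∎
    where
    regroup : ∀ x y u v → (x + y) * 1 + (u + v) ≡ (y * 1 + u) + (x * 1 + v)
    regroup = solve-∀

  JF : ℕ → ℕ → ℕ
  JF n k = diagonal n 0 k

  JF-rec : ∀ n k → JF (2 + n) (suc k) ≡ JF (1 + n) (suc k) + JF n (suc k) + JF n k
  JF-rec n k = diagonal-pascal n 0 k

  JF-rec₀ : ∀ n → JF (2 + n) 0 ≡ JF (1 + n) 0 + JF n 0
  JF-rec₀ n = cong suc (diagonal-pascal₀ n 0)

  double : ℕ → ℕ
  double zero    = 0
  double (suc k) = suc (suc (double k))

  double≡+ : ∀ k → double k ≡ k + k
  double≡+ zero    = refl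
  double≡+ (suc k) = cong suc (trans (cong suc (double≡+ k)) (sym (+-suc k k)))

  JF-vanish : ∀ n k → n < double k → JF n k ≡ 0
  JF-vanish zero          (suc k) _                = refl
  JF-vanish (suc zero)    (suc k) _                = refl
  JF-vanish (suc (suc n)) (suc k) (s≤s (s≤s n<2k)) = trans (JF-rec n k) (cong₂ _+_
    (cong₂ _+_ (JF-vanish (suc n) (suc k) (s<s (m<n⇒m<1+n n<2k)))
               (JF-vanish n (suc k) (m<n⇒m<1+n (m<n⇒m<1+n n<2k))))
    (JF-vanish n k n<2k))

  JF-fibConv : ∀ k m → JF (m + double k) k ≡ fibConv (suc k) m
  JF-fibConv zero    zero          = refl
  JF-fibConv zero    (suc zero)    = refl
  JF-fibConv zero    (suc (suc m)) = begin
    JF (2 + (m + 0)) 0                   ≡⟨ JF-rec₀ (m + 0) ⟩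
    JF (1 + (m + 0)) 0 + JF (m + 0) 0    ≡⟨ cong₂ _+_ (JF-fibConv zero (suc m)) (JF-fibConv zero m) ⟩
    fibConv 1 (suc m) + fibConv 1 m      ≡⟨ +-identityʳ _ ⟨
    fibConv 1 (suc (suc m))              ∎
  JF-fibConv (suc k) zero          = begin
    JF (2 + double k) (suc k)                                            ≡⟨ JF-rec (double k) k ⟩
    JF (1 + double k) (suc k) + JF (double k) (suc k) + JF (double k) k
      ≡⟨ cong₂ _+_ (cong₂ _+_ (JF-vanish (1 + double k) (suc k) (n<1+n _))
                              (JF-vanish (double k) (suc k) (m<n⇒m<1+n (n<1+n _))))
                   (JF-fibConv k zero) ⟩
    fibConv (2 + k) 0                                                    ∎
  JF-fibConv (suc k) (suc zero)    = begin
    JF (3 + double k) (suc k)                                                ≡⟨ JF-rec (1 + double k) k ⟩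
    JF (2 + double k) (suc k) + JF (1 + double k) (suc k) + JF (1 + double k) k
      ≡⟨ cong₂ _+_ (cong₂ _+_ (JF-fibConv (suc k) zero) (JF-vanish (1 + double k) (suc k) (n<1+n _)))
                   (JF-fibConv k 1) ⟩
    fibConv (2 + k) 1                                                        ∎
  JF-fibConv (suc k) (suc (suc m)) = begin
    JF (2 + (m + D)) (suc k)                                       ≡⟨ JF-rec (m + D) k ⟩
    JF (1 + (m + D)) (suc k) + JF (m + D) (suc k) + JF (m + D) k
      ≡⟨ cong₂ _+_ (cong₂ _+_ (JF-fibConv (suc k) (suc m)) (JF-fibConv (suc k) m))
                   (trans (cong (λ n → JF n k) (trans (+-suc m _) (cong suc (+-suc m _)))) (JF-fibConv k (2 + m))) ⟩
    fibConv (2 + k) (2 + m)                                        ∎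
    where D = double (suc k)

  -- n/(n - t)·C(n - t, t), the coefficient of xᵗ in the Lucas polynomial Lₙ(x),
  -- written without division (valid for t < n).
  lucas : ℕ → ℕ → ℕ
  lucas n zero    = 1
  lucas n (suc t) = ((n ∸ suc t) C suc t) + ((n ∸ suc (suc t)) C t)

  JLℕ : ℕ → ℕ → ℕ
  JLℕ n k = sumFrom 0 (suc n) (λ t → lucas n t * (t C k))

  JLℕ-split : ∀ n k → JLℕ n k ≡ JF n k + sumFrom 0 n (λ t → ((n ∸ suc (suc t)) C t) * (suc t C k))
  JLℕ-split n k = begin
      1 * (0 C k) + sumFrom 1 n (λ t → lucas n t * (t C k))
    ≡⟨ cong (1 * (0 C k) +_) (sumFrom-shift 0 n (λ t → lucas n t * (t C k))) ⟩
      1 * (0 C k) + sumFrom 0 n (λ t → lucas n (suc t) * (suc t C k))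
    ≡⟨ cong (1 * (0 C k) +_) (sumFrom-cong 0 n distribute) ⟩
      1 * (0 C k) + sumFrom 0 n (λ t → A t + B t)
    ≡⟨ cong (1 * (0 C k) +_) (sumFrom-+ 0 n A B) ⟩
      1 * (0 C k) + (sumFrom 0 n A + sumFrom 0 n B)
    ≡⟨ +-assoc (1 * (0 C k)) _ _ ⟨
      1 * (0 C k) + sumFrom 0 n A + sumFrom 0 n B
    ≡⟨ cong (_+ sumFrom 0 n B) JF-head ⟨
      JF n k + sumFrom 0 n B
    ∎
    where
    A B : ℕ → ℕ
    A t = ((n ∸ suc t) C suc t) * (suc t C k)
    B t = ((n ∸ suc (suc t)) C t) * (suc t C k)
    distribute : ∀ t → lucas n (suc t) * (suc t C k) ≡ A t + B t
    distribute t = *-distribʳ-+ (suc t C k) ((n ∸ suc t) C suc t) ((n ∸ suc (suc t)) C t)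
    JF-head : JF n k ≡ 1 * (0 C k) + sumFrom 0 n A
    JF-head = trans (diagonal-sum n 0 k) (cong (1 * (0 C k) +_) (sumFrom-shift 0 n (λ t → ((n ∸ t) C t) * (t C k))))

  JF-step : ∀ n k → JF (2 + n) k ≡ JF (1 + n) k + sumFrom 0 (suc n) (λ t → ((n ∸ t) C t) * (suc t C k))
  JF-step n zero    = trans (JF-rec₀ n) (cong (JF (1 + n) 0 +_) (diagonal-sum n 0 0))
  JF-step n (suc k) = begin
      JF (2 + n) (suc k)                                   ≡⟨ JF-rec n k ⟩
      JF (1 + n) (suc k) + JF n (suc k) + JF n k           ≡⟨ +-assoc (JF (1 + n) (suc k)) _ _ ⟩
      JF (1 + n) (suc k) + (JF n (suc k) + JF n k)         ≡⟨ cong (JF (1 + n) (suc k) +_) lower ⟩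
      JF (1 + n) (suc k) + sumFrom 0 (suc n) (λ t → ((n ∸ t) C t) * (suc t C suc k)) ∎
    where
    lower : JF n (suc k) + JF n k ≡ sumFrom 0 (suc n) (λ t → ((n ∸ t) C t) * (suc t C suc k))
    lower = begin
      JF n (suc k) + JF n k
        ≡⟨ +-comm (JF n (suc k)) (JF n k) ⟩
      JF n k + JF n (suc k)
        ≡⟨ cong₂ _+_ (diagonal-sum n 0 k) (diagonal-sum n 0 (suc k)) ⟩
      sumFrom 0 (suc n) (λ t → ((n ∸ t) C t) * (t C k)) + sumFrom 0 (suc n) (λ t → ((n ∸ t) C t) * (t C suc k))
        ≡⟨ sumFrom-+ 0 (suc n) (λ t → ((n ∸ t) C t) * (t C k)) (λ t → ((n ∸ t) C t) * (t C suc k)) ⟨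
      sumFrom 0 (suc n) (λ t → ((n ∸ t) C t) * (t C k) + ((n ∸ t) C t) * (t C suc k))
        ≡⟨ sumFrom-cong 0 (suc n) (λ t → trans (sym (*-distribˡ-+ ((n ∸ t) C t) (t C k) (t C suc k)))
                                                (cong (((n ∸ t) C t) *_) (sym (pascal t k)))) ⟩
      sumFrom 0 (suc n) (λ t → ((n ∸ t) C t) * (suc t C suc k)) ∎

  JLℕ-JF : ∀ n k → JLℕ (2 + n) k + JF (1 + n) k ≡ 2 * JF (2 + n) k
  JLℕ-JF n k = begin
      JLℕ (2 + n) k + JF (1 + n) k
    ≡⟨ cong (_+ JF (1 + n) k) (JLℕ-split (2 + n) k) ⟩
      JF (2 + n) k + sumFrom 0 (2 + n) h + JF (1 + n) k
    ≡⟨ cong (λ x → JF (2 + n) k + x + JF (1 + n) k) drop-last ⟩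
      JF (2 + n) k + sumFrom 0 (suc n) h + JF (1 + n) k
    ≡⟨ +-assoc (JF (2 + n) k) _ _ ⟩
      JF (2 + n) k + (sumFrom 0 (suc n) h + JF (1 + n) k)
    ≡⟨ cong (JF (2 + n) k +_) (trans (+-comm _ (JF (1 + n) k)) (sym (JF-step n k))) ⟩
      JF (2 + n) k + JF (2 + n) k
    ≡⟨ cong (JF (2 + n) k +_) (+-identityʳ _) ⟨
      2 * JF (2 + n) k
    ∎
    where
    h : ℕ → ℕ
    h t = ((n ∸ t) C t) * (suc t C k)
    drop-last : sumFrom 0 (2 + n) h ≡ sumFrom 0 (suc n) h
    drop-last = begin
      sumFrom 0 (2 + n) h                   ≡⟨ sumFrom-snoc 0 (suc n) h ⟩
      sumFrom 0 (suc n) h + h (suc n + 0)   ≡⟨ cong (λ x → sumFrom 0 (suc n) h + x * (suc (suc n + 0) C k))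
                                                    (k>n⇒nCk≡0 (s≤s (≤-trans (m∸n≤m n (suc n + 0)) (m≤m+n n 0)))) ⟩
      sumFrom 0 (suc n) h + 0               ≡⟨ +-identityʳ _ ⟩
      sumFrom 0 (suc n) h                   ∎

  JLℕ-fibConv : ∀ k m → JLℕ ((2 + m) + double k) k + fibConv (suc k) (1 + m) ≡ 2 * fibConv (suc k) (2 + m)
  JLℕ-fibConv k m = begin
    JLℕ ((2 + m) + double k) k + fibConv (suc k) (1 + m)  ≡⟨ cong (JLℕ ((2 + m) + double k) k +_) (JF-fibConv k (1 + m)) ⟨
    JLℕ ((2 + m) + double k) k + JF ((1 + m) + double k) k ≡⟨ JLℕ-JF (m + double k) k ⟩
    2 * JF ((2 + m) + double k) k                         ≡⟨ cong (2 *_) (JF-fibConv k (2 + m)) ⟩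
    2 * fibConv (suc k) (2 + m)                           ∎

  half<⇒< : ∀ n t → n / 2 < t → n < t + t
  half<⇒< n t n/2<t = ≰⇒> λ t+t≤n →
    <⇒≱ n/2<t (subst (_≤ n / 2) (m*n/n≡m t 2) (/-monoˡ-≤ 2 (subst (_≤ n) t+t≡t*2 t+t≤n)))
    where
    t+t≡t*2 : t + t ≡ t * 2
    t+t≡t*2 = solve (t ∷ [])

  lucas-vanish : ∀ n t → 2 ≤ n → n / 2 < t → lucas n t ≡ 0
  lucas-vanish n (suc zero)    2≤n n/2<1 = ⊥-elim (<⇒≱ (half<⇒< n 1 n/2<1) 2≤n)
  lucas-vanish n (suc (suc j)) _   n/2<t = cong₂ _+_
    (k>n⇒nCk≡0 (m<n+o⇒m∸n<o n (2 + j) n<))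
    (k>n⇒nCk≡0 (m<n+o⇒m∸n<o n (3 + j) (subst (n <_) regroup n<)))
    where
    n< : n < (2 + j) + (2 + j)
    n< = half<⇒< n (2 + j) n/2<t
    regroup : (2 + j) + (2 + j) ≡ (3 + j) + (1 + j)
    regroup = solve (j ∷ [])

module SecondDifference where

  open import Data.Nat
  open import Data.Nat.Properties
  open import Data.Empty using (⊥)
  open import Data.Product using (_×_; _,_; ∃; proj₁; proj₂)
  open import Data.List.Base using (_∷_; [])
  open import Data.Nat.Tactic.RingSolver using (solve; solve-∀)
  open import Relation.Binary.PropositionalEquality

  open FibonacciConvolution
  open LucasSums using (JLℕ; JLℕ-fibConv; double)

  -- In terms of t = x / y: b / a lies beyond the positive root and the vertex of m t² - p t - q.
  quadratic⇒ratio< : ∀ m p q a b x y → 0 < y →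
    p * (a * b) + q * (a * a) < m * (b * b) → p * a ≤ 2 * m * b →
    m * (x * x) ≤ p * (x * y) + q * (y * y) → a * x < b * y
  quadratic⇒ratio< m p q a b x y 0<y root vertex quad = ≰⇒> λ by≤ax → refute (m≤n⇒∃[o]m+o≡n by≤ax)
    where
    open ≤-Reasoning
    instance
      y≢0 : NonZero y
      y≢0 = >-nonZero 0<y
      y*y≢0 : NonZero (y * y)
      y*y≢0 = m*n≢0 y y
    refute : ∃ (λ d → b * y + d ≡ a * x) → ⊥
    refute (d , by+d≡ax) = <⇒≱ (begin-strict
      a * a * (p * (x * y) + q * (y * y))               ≡⟨ solve (a ∷ p ∷ q ∷ x ∷ y ∷ []) ⟩
      p * a * y * (a * x) + q * (a * a) * (y * y)       ≡⟨ cong (λ t → p * a * y * t + q * (a * a) * (y * y)) by+d≡ax ⟨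
      p * a * y * (b * y + d) + q * (a * a) * (y * y)   ≡⟨ solve (a ∷ b ∷ p ∷ q ∷ y ∷ d ∷ []) ⟩
      (p * (a * b) + q * (a * a)) * (y * y) + p * a * (y * d)
                                                        <⟨ +-mono-<-≤ (*-monoˡ-< (y * y) root) (*-monoˡ-≤ (y * d) vertex) ⟩
      m * (b * b) * (y * y) + 2 * m * b * (y * d)       ≤⟨ m≤m+n _ (m * (d * d)) ⟩
      m * (b * b) * (y * y) + 2 * m * b * (y * d) + m * (d * d)
                                                        ≡⟨ solve (m ∷ b ∷ y ∷ d ∷ []) ⟩
      m * ((b * y + d) * (b * y + d))                   ≡⟨ cong (λ t → m * (t * t)) by+d≡ax ⟩
      m * ((a * x) * (a * x))                           ≡⟨ solve (m ∷ a ∷ x ∷ []) ⟩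
      a * a * (m * (x * x))                             ∎) (*-monoʳ-≤ (a * a) quad)

  -- With M = 4k + r and K = k + 1 these are (M + 4)(M + 5) - K(M + 7 - 2K) and
  -- 2(M + 3)(M + 5) - 4K(K - 1), written in k and r to avoid truncated
  -- subtraction: (M + 5)·K·Φ(2k + M + 4, k) = β·D₃ - α·D₄ with Dⱼ = fibConv K (M + j).
  α β : ℕ → ℕ → ℕ
  α k r = 15 + 8 * r + r * r + 29 * k + 7 * k * r + 14 * k * k
  β k r = 30 + 16 * r + 2 * r * r + 60 * k + 16 * k * r + 28 * k * k

  α-β-coefficients : ∀ k r → let M = 4 * k + r ; K = suc k in
    α k r + K * (M + 7) ≡ (M + 4) * (M + 5) + 2 * (K * K) ×
    β k r + K * (3 * M + 11 + 4 * K) ≡ (M + 5) * (2 * M + 6 + 3 * K)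
  α-β-coefficients k r = identityα k r , identityβ k r
    where
    identityα : ∀ k r → let M = 4 * k + r ; K = suc k in
      15 + 8 * r + r * r + 29 * k + 7 * k * r + 14 * k * k + K * (M + 7) ≡ (M + 4) * (M + 5) + 2 * (K * K)
    identityα = solve-∀
    identityβ : ∀ k r → let M = 4 * k + r ; K = suc k in
      30 + 16 * r + 2 * r * r + 60 * k + 16 * k * r + 28 * k * k + K * (3 * M + 11 + 4 * K) ≡
      (M + 5) * (2 * M + 6 + 3 * K)
    identityβ = solve-∀

  α-β-beyond-root : ∀ k r → let m = 4 + (4 * k + r) in
    (m + k) * (α k r * β k r) + (m + 2 * k) * (α k r * α k r) < m * (β k r * β k r) ×
    (m + k) * α k r ≤ 2 * m * β k r
  α-β-beyond-root k r =
    (begin-strict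
       (m + k) * (α k r * β k r) + (m + 2 * k) * (α k r * α k r)        <⟨ m<m+n _ z<s ⟩
       (m + k) * (α k r * β k r) + (m + 2 * k) * (α k r * α k r) + rootSlack  ≡⟨ rootCertificate k r ⟩
       m * (β k r * β k r)                                              ∎)
    , (begin
       (m + k) * α k r               ≤⟨ m≤m+n _ vertexSlack ⟩
       (m + k) * α k r + vertexSlack ≡⟨ vertexCertificate k r ⟩
       2 * m * β k r                 ∎)
    where
    open ≤-Reasoning
    m = 4 + (4 * k + r)
    rootSlack = 900 + 1185 * r + 616 * r * r + 158 * r * r * r + 20 * r * r * r * r + r * r * r * r * r
      + 3840 * k + 4208 * k * r + 1708 * k * r * r + 304 * k * r * r * r + 20 * k * r * r * r * r
      + 6086 * k * k + 5361 * k * k * r + 1544 * k * k * r * r + 145 * k * k * r * r * r + 4238 * k * k * k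
      + 2840 * k * k * k * r + 450 * k * k * k * r * r + 1092 * k * k * k * k + 504 * k * k * k * k * r
    vertexSlack = 180 + 141 * r + 36 * r * r + 3 * r * r * r + 529 * k + 279 * k * r + 36 * k * r * r
      + 503 * k * k + 135 * k * k * r + 154 * k * k * k
    rootCertificate : ∀ k r → let m = 4 + (4 * k + r)
                                  a = 15 + 8 * r + r * r + 29 * k + 7 * k * r + 14 * k * k
                                  b = 30 + 16 * r + 2 * r * r + 60 * k + 16 * k * r + 28 * k * k in
      (m + k) * (a * b) + (m + 2 * k) * (a * a)
        + (900 + 1185 * r + 616 * r * r + 158 * r * r * r + 20 * r * r * r * r + r * r * r * r * r
           + 3840 * k + 4208 * k * r + 1708 * k * r * r + 304 * k * r * r * r + 20 * k * r * r * r * r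
           + 6086 * k * k + 5361 * k * k * r + 1544 * k * k * r * r + 145 * k * k * r * r * r + 4238 * k * k * k
           + 2840 * k * k * k * r + 450 * k * k * k * r * r + 1092 * k * k * k * k + 504 * k * k * k * k * r)
      ≡ m * (b * b)
    rootCertificate = solve-∀
    vertexCertificate : ∀ k r → let m = 4 + (4 * k + r)
                                    a = 15 + 8 * r + r * r + 29 * k + 7 * k * r + 14 * k * k
                                    b = 30 + 16 * r + 2 * r * r + 60 * k + 16 * k * r + 28 * k * k in
      (m + k) * a + (180 + 141 * r + 36 * r * r + 3 * r * r * r + 529 * k + 279 * k * r + 36 * k * r * r
                     + 503 * k * k + 135 * k * k * r + 154 * k * k * k)
      ≡ 2 * m * b
    vertexCertificate = solve-∀

  α·D₄<β·D₃ : ∀ k r → let M = 4 * k + r in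
    α k r * fibConv (suc k) (4 + M) < β k r * fibConv (suc k) (3 + M)
  α·D₄<β·D₃ zero    r = begin-strict
    α 0 r * fibConv 1 (4 + r)          <⟨ *-monoʳ-< (α 0 r) (fibonacci-<-double (1 + r)) ⟩
    α 0 r * (2 * fibConv 1 (3 + r))    ≡⟨ *-assoc (α 0 r) 2 (fibConv 1 (3 + r)) ⟨
    α 0 r * 2 * fibConv 1 (3 + r)      ≡⟨ cong (_* fibConv 1 (3 + r)) (doubling r) ⟩
    β 0 r * fibConv 1 (3 + r)          ∎
    where
    open ≤-Reasoning
    doubling : ∀ r → (15 + 8 * r + r * r + 29 * 0 + 7 * 0 * r + 14 * 0 * 0) * 2 ≡
                     30 + 16 * r + 2 * r * r + 60 * 0 + 16 * 0 * r + 28 * 0 * 0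
    doubling = solve-∀
  α·D₄<β·D₃ (suc k) r =
    let m = 4 + (4 * suc k + r)
        root , vertex = α-β-beyond-root (suc k) r
    in quadratic⇒ratio< m (m + suc k) (m + 2 * suc k) (α (suc k) r) (β (suc k) r)
         (fibConv (2 + k) (4 + (4 * suc k + r))) (fibConv (2 + k) (3 + (4 * suc k + r)))
         (fibConv-positive (suc k) (3 + (4 * suc k + r))) root vertex
         (fibConv-quadratic k (1 + (4 * suc k + r)))

  difference-k+1 : ∀ M K A C E₁ E₂ D₃ D₄ →
    A + E₂ ≡ 2 * (E₂ + E₁ + D₃) → C + E₁ ≡ 2 * E₂ →
    K * (E₂ + 2 * E₁) ≡ (3 + M) * D₃ → K * ((E₂ + E₁ + D₃) + 2 * E₂) ≡ (4 + M) * D₄ →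
    K * A + (4 + M) * D₄ ≡ K * C + (2 * M + 6 + 3 * K) * D₃
  difference-k+1 M K A C E₁ E₂ D₃ D₄ hA hC h₃ h₄ = +-cancelʳ-≡ (K * E₂ + K * E₁) _ _ (begin
      K * A + (4 + M) * D₄ + (K * E₂ + K * E₁)
    ≡⟨ solve (M ∷ K ∷ A ∷ E₁ ∷ E₂ ∷ D₄ ∷ []) ⟩
      K * (A + E₂) + (4 + M) * D₄ + K * E₁
    ≡⟨ cong₂ (λ u v → K * u + v + K * E₁) hA (sym h₄) ⟩
      K * (2 * (E₂ + E₁ + D₃)) + K * ((E₂ + E₁ + D₃) + 2 * E₂) + K * E₁
    ≡⟨ solve (K ∷ E₁ ∷ E₂ ∷ D₃ ∷ []) ⟩
      K * (2 * E₂) + 2 * (K * (E₂ + 2 * E₁)) + 3 * K * D₃ + K * E₂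
    ≡⟨ cong₂ (λ u v → K * u + 2 * v + 3 * K * D₃ + K * E₂) (sym hC) h₃ ⟩
      K * (C + E₁) + 2 * ((3 + M) * D₃) + 3 * K * D₃ + K * E₂
    ≡⟨ solve (M ∷ K ∷ C ∷ E₁ ∷ E₂ ∷ D₃ ∷ []) ⟩
      K * C + (2 * M + 6 + 3 * K) * D₃ + (K * E₂ + K * E₁)
    ∎)
    where open ≡-Reasoning

  difference-k : ∀ M K B D D₃ D₄ D₅ →
    B + D₄ ≡ 2 * D₅ → D + D₃ ≡ 2 * D₄ → (5 + M) * D₅ ≡ (4 + M + K) * D₄ + (3 + M + 2 * K) * D₃ →
    (5 + M) * D + (3 * M + 11 + 4 * K) * D₃ + 2 * K * D₄ ≡ (5 + M) * B + (M + 7) * D₄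
  difference-k M K B D D₃ D₄ D₅ hB hD h₅ = +-cancelʳ-≡ ((5 + M) * (D₃ + D₄)) _ _ (begin
      (5 + M) * D + (3 * M + 11 + 4 * K) * D₃ + 2 * K * D₄ + (5 + M) * (D₃ + D₄)
    ≡⟨ solve (M ∷ K ∷ D ∷ D₃ ∷ D₄ ∷ []) ⟩
      (5 + M) * (D + D₃) + (5 + M) * D₄ + (3 * M + 11 + 4 * K) * D₃ + 2 * K * D₄
    ≡⟨ cong (λ u → (5 + M) * u + (5 + M) * D₄ + (3 * M + 11 + 4 * K) * D₃ + 2 * K * D₄) hD ⟩
      (5 + M) * (2 * D₄) + (5 + M) * D₄ + (3 * M + 11 + 4 * K) * D₃ + 2 * K * D₄
    ≡⟨ solve (M ∷ K ∷ D₃ ∷ D₄ ∷ []) ⟩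
      2 * ((4 + M + K) * D₄ + (3 + M + 2 * K) * D₃) + (5 + M) * D₃ + (M + 7) * D₄
    ≡⟨ cong (λ u → 2 * u + (5 + M) * D₃ + (M + 7) * D₄) h₅ ⟨
      2 * ((5 + M) * D₅) + (5 + M) * D₃ + (M + 7) * D₄
    ≡⟨ solve (M ∷ D₃ ∷ D₄ ∷ D₅ ∷ []) ⟩
      (5 + M) * (2 * D₅) + (5 + M) * D₃ + (M + 7) * D₄
    ≡⟨ cong (λ u → (5 + M) * u + (5 + M) * D₃ + (M + 7) * D₄) hB ⟨
      (5 + M) * (B + D₄) + (5 + M) * D₃ + (M + 7) * D₄
    ≡⟨ solve (M ∷ B ∷ D₃ ∷ D₄ ∷ []) ⟩
      (5 + M) * B + (M + 7) * D₄ + (5 + M) * (D₃ + D₄)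
    ∎)
    where open ≡-Reasoning

  differences⇒second-difference : ∀ M K a b A B C D D₃ D₄ →
    K * A + (4 + M) * D₄ ≡ K * C + (2 * M + 6 + 3 * K) * D₃ →
    (5 + M) * D + (3 * M + 11 + 4 * K) * D₃ + 2 * K * D₄ ≡ (5 + M) * B + (M + 7) * D₄ →
    a + K * (M + 7) ≡ (M + 4) * (M + 5) + 2 * (K * K) →
    b + K * (3 * M + 11 + 4 * K) ≡ (M + 5) * (2 * M + 6 + 3 * K) →
    (5 + M) * K * (A + D) + a * D₄ ≡ (5 + M) * K * (B + C) + b * D₃
  differences⇒second-difference M K a b A B C D D₃ D₄ upper lower ha hb =
    let c₁ = 2 * M + 6 + 3 * K
        c₂ = 3 * M + 11 + 4 * K
        Z  = K * c₂ * D₃ + K * (M + 7) * D₄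
    in +-cancelʳ-≡ Z _ _ (begin
      (5 + M) * K * (A + D) + a * D₄ + Z
    ≡⟨ solve (M ∷ K ∷ a ∷ A ∷ D ∷ D₃ ∷ D₄ ∷ []) ⟩
      (5 + M) * K * A + (5 + M) * K * D + K * c₂ * D₃ + (a + K * (M + 7)) * D₄
    ≡⟨ cong (λ u → (5 + M) * K * A + (5 + M) * K * D + K * c₂ * D₃ + u * D₄) ha ⟩
      (5 + M) * K * A + (5 + M) * K * D + K * c₂ * D₃ + ((M + 4) * (M + 5) + 2 * (K * K)) * D₄
    ≡⟨ solve (M ∷ K ∷ A ∷ D ∷ D₃ ∷ D₄ ∷ []) ⟩
      (5 + M) * (K * A + (4 + M) * D₄) + K * ((5 + M) * D + c₂ * D₃ + 2 * K * D₄)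
    ≡⟨ cong₂ (λ u v → (5 + M) * u + K * v) upper lower ⟩
      (5 + M) * (K * C + c₁ * D₃) + K * ((5 + M) * B + (M + 7) * D₄)
    ≡⟨ solve (M ∷ K ∷ B ∷ C ∷ D₃ ∷ D₄ ∷ []) ⟩
      (5 + M) * K * (B + C) + (M + 5) * c₁ * D₃ + K * (M + 7) * D₄
    ≡⟨ cong (λ u → (5 + M) * K * (B + C) + u * D₃ + K * (M + 7) * D₄) hb ⟨
      (5 + M) * K * (B + C) + (b + K * c₂) * D₃ + K * (M + 7) * D₄
    ≡⟨ solve (M ∷ K ∷ b ∷ B ∷ C ∷ D₃ ∷ D₄ ∷ []) ⟩
      (5 + M) * K * (B + C) + b * D₃ + Z
    ∎)
    where open ≡-Reasoning

  JLℕ-second-difference : ∀ k r → let n = (4 + (4 * k + r)) + double k in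
    JLℕ (suc n) k + JLℕ n (suc k) < JLℕ (suc n) (suc k) + JLℕ n k
  JLℕ-second-difference k r =
    *-cancelˡ-< ((5 + M) * K) _ _ (+-cancelʳ-< (β k r * D₃) _ _ (begin-strict
      (5 + M) * K * (B + C) + β k r * D₃   ≡⟨ identity ⟨
      (5 + M) * K * (A + D) + α k r * D₄   <⟨ +-monoʳ-< ((5 + M) * K * (A + D)) (α·D₄<β·D₃ k r) ⟩
      (5 + M) * K * (A + D) + β k r * D₃   ∎))
    where
    open ≤-Reasoning
    M = 4 * k + r
    K = suc k
    n = (4 + M) + double k
    A = JLℕ (suc n) (suc k)
    B = JLℕ (suc n) k
    C = JLℕ n (suc k)
    D = JLℕ n k
    E₁ = fibConv (2 + k) (1 + M)
    E₂ = fibConv (2 + k) (2 + M)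
    D₃ = fibConv K (3 + M)
    D₄ = fibConv K (4 + M)
    D₅ = fibConv K (5 + M)

    shift : ∀ a → a + double (suc k) ≡ 2 + a + double k
    shift a = trans (+-suc a _) (cong suc (+-suc a _))

    hA : A + E₂ ≡ 2 * (E₂ + E₁ + D₃)
    hA = subst (λ x → JLℕ x (suc k) + E₂ ≡ 2 * (E₂ + E₁ + D₃)) (shift (3 + M)) (JLℕ-fibConv (suc k) (1 + M))
    hC : C + E₁ ≡ 2 * E₂
    hC = subst (λ x → JLℕ x (suc k) + E₁ ≡ 2 * E₂) (shift (2 + M)) (JLℕ-fibConv (suc k) M)

    identity : (5 + M) * K * (A + D) + α k r * D₄ ≡ (5 + M) * K * (B + C) + β k r * D₃
    identity = differences⇒second-difference M K (α k r) (β k r) A B C D D₃ D₄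
      (difference-k+1 M K A C E₁ E₂ D₃ D₄ hA hC (fibConv-derivative K (1 + M)) (fibConv-derivative K (2 + M)))
      (difference-k M K B D D₃ D₄ D₅ (JLℕ-fibConv k (3 + M)) (JLℕ-fibConv k (2 + M)) (fibConv-recurrence K (3 + M)))
      (proj₁ (α-β-coefficients k r)) (proj₂ (α-β-coefficients k r))

module RationalForm where

  open import Data.Nat as ℕ using (ℕ; zero; suc; _∸_; _≤_)
  import Data.Nat.Properties as ℕ
  open import Data.Nat.Combinatorics using (_C_; k>n⇒nCk≡0)
  open import Data.Nat.DivMod using (m/n≤m; m/n<m)
  open import Data.List.Base using (_∷_; [])
  open import Data.Nat.Tactic.RingSolver using (solve; solve-∀)
  open import Data.Product using (_,_)
  open import Data.Integer as ℤ using (+_)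
  import Data.Integer.Properties as ℤ
  open import Data.Rational as ℚ using (ℚ; 0ℚ; _+_; _<_)
  open import Data.Rational.Properties
    using (toℚᵘ-injective; toℚᵘ-homo-+; toℚᵘ-fromℚᵘ; fromℚᵘ-cong; toℚᵘ-cancel-<; 0/n≡0)
  import Data.Rational.Unnormalised as ℚᵘ
  import Data.Rational.Unnormalised.Properties as ℚᵘ
  open import Relation.Nullary using (yes; no)
  open import Relation.Binary.PropositionalEquality

  open LucasSums

  fromℕ : ℕ → ℚ
  fromℕ a = + a ℚ./ 1

  fromℕ-0 : fromℕ 0 ≡ 0ℚ
  fromℕ-0 = 0/n≡0 1

  fromℕ-+ : ∀ a b → fromℕ a + fromℕ b ≡ fromℕ (a ℕ.+ b)
  fromℕ-+ a b = toℚᵘ-injective (ℚᵘ.≃-trans (toℚᵘ-homo-+ (fromℕ a) (fromℕ b))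
    (ℚᵘ.≃-trans (ℚᵘ.+-cong (toℚᵘ-fromℚᵘ (ℚᵘ.mkℚᵘ (+ a) 0)) (toℚᵘ-fromℚᵘ (ℚᵘ.mkℚᵘ (+ b) 0)))
    (ℚᵘ.≃-trans (ℚᵘ.*≡* cross) (ℚᵘ.≃-sym (toℚᵘ-fromℚᵘ (ℚᵘ.mkℚᵘ (+ (a ℕ.+ b)) 0))))))
    where
    cross : ((+ a) ℤ.* (+ 1) ℤ.+ (+ b) ℤ.* (+ 1)) ℤ.* (+ 1) ≡ (+ (a ℕ.+ b)) ℤ.* (+ 1)
    cross = cong (ℤ._* (+ 1)) (trans (cong₂ ℤ._+_ (ℤ.*-identityʳ (+ a)) (ℤ.*-identityʳ (+ b))) (sym (ℤ.pos-+ a b)))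

  fromℕ-mono-< : ∀ {a b} → a ℕ.< b → fromℕ a < fromℕ b
  fromℕ-mono-< {a} {b} a<b = toℚᵘ-cancel-<
    (ℚᵘ.<-respʳ-≃ (ℚᵘ.≃-sym (toℚᵘ-fromℚᵘ (ℚᵘ.mkℚᵘ (+ b) 0)))
      (ℚᵘ.<-respˡ-≃ (ℚᵘ.≃-sym (toℚᵘ-fromℚᵘ (ℚᵘ.mkℚᵘ (+ a) 0)))
        (ℚᵘ.*<* (subst₂ ℤ._<_ (sym (ℤ.*-identityʳ (+ a))) (sym (ℤ.*-identityʳ (+ b))) (ℤ.+<+ a<b)))))

  frac-cancel : ∀ c b → frac (c ℕ.* suc b) (suc b) ≡ fromℕ c
  frac-cancel c b = fromℚᵘ-cong {ℚᵘ.mkℚᵘ (+ (c ℕ.* suc b)) b} {ℚᵘ.mkℚᵘ (+ c) 0}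
    (ℚᵘ.*≡* (trans (ℤ.*-identityʳ (+ (c ℕ.* suc b))) (ℤ.pos-* c (suc b))))

  loop-fromℕ : (f : ℕ → ℚ) (h : ℕ → ℕ) → (∀ t → f t ≡ fromℕ (h t)) → (loop : ℕ → ℕ → ℚ) →
    (∀ i → loop 0 i ≡ 0ℚ) → (∀ c i → loop (suc c) i ≡ f i + loop c (suc i)) →
    ∀ c i → loop c i ≡ fromℕ (sumFrom i c h)
  loop-fromℕ f h f≡h loop loop₀ loopₛ zero    i = trans (loop₀ i) (sym fromℕ-0)
  loop-fromℕ f h f≡h loop loop₀ loopₛ (suc c) i = begin
    loop (suc c) i                               ≡⟨ loopₛ c i ⟩
    f i + loop c (suc i)                         ≡⟨ cong₂ _+_ (f≡h i) (loop-fromℕ f h f≡h loop loop₀ loopₛ c (suc i)) ⟩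
    fromℕ (h i) + fromℕ (sumFrom (suc i) c h)    ≡⟨ fromℕ-+ (h i) _ ⟩
    fromℕ (sumFrom i (suc c) h)                  ∎
    where open ≡-Reasoning

  -- The summation loop local to sumFromTo cannot be named: abstracting its
  -- count and start index lets unification recover it for loop-fromℕ.
  sumFromTo-fromℕ : ∀ lo hi (f : ℕ → ℚ) (h : ℕ → ℕ) → (∀ t → f t ≡ fromℕ (h t)) →
                    sumFromTo lo hi f ≡ fromℕ (sumFrom lo (suc hi ∸ lo) h)
  sumFromTo-fromℕ lo hi f h f≡h = unfold (loop-fromℕ f h f≡h loop (λ _ → refl) (λ _ _ → refl))
    where
    loop : ℕ → ℕ → ℚ
    loop = _
    unfold : (∀ c i → loop c i ≡ fromℕ (sumFrom i c h)) → sumFromTo lo hi f ≡ fromℕ (sumFrom lo (suc hi ∸ lo) h)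
    unfold loop≡ with suc hi ∸ lo
    ... | zero  = sym fromℕ-0
    ... | suc c with suc lo
    ...   | i   = trans (cong₂ _+_ (f≡h lo) (loop≡ c i)) (fromℕ-+ (h lo) _)

  absorbed-term : ∀ j b k → let n = suc j ℕ.+ suc b in
    frac (n ℕ.* ((n ∸ suc j) C suc j) ℕ.* (suc j C k)) (n ∸ suc j) ≡ fromℕ (lucas n (suc j) ℕ.* (suc j C k))
  absorbed-term j b k = begin
      frac (n ℕ.* ((n ∸ suc j) C suc j) ℕ.* Y) (n ∸ suc j)
    ≡⟨ cong (λ d → frac (n ℕ.* (d C suc j) ℕ.* Y) d) n∸1+j ⟩
      frac (n ℕ.* (suc b C suc j) ℕ.* Y) (suc b)
    ≡⟨ cong (λ x → frac x (suc b)) (numerator (suc b C suc j) Y (b C j) (absorption b j)) ⟩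
      frac (((suc b C suc j) ℕ.+ (b C j)) ℕ.* Y ℕ.* suc b) (suc b)
    ≡⟨ frac-cancel (((suc b C suc j) ℕ.+ (b C j)) ℕ.* Y) b ⟩
      fromℕ (((suc b C suc j) ℕ.+ (b C j)) ℕ.* Y)
    ≡⟨ cong₂ (λ d e → fromℕ (((d C suc j) ℕ.+ (e C j)) ℕ.* Y)) n∸1+j n∸2+j ⟨
      fromℕ (lucas n (suc j) ℕ.* Y)
    ∎
    where
    open ≡-Reasoning
    n = suc j ℕ.+ suc b
    Y = suc j C k
    n∸1+j : n ∸ suc j ≡ suc b
    n∸1+j = ℕ.m+n∸m≡n j (suc b)
    n∸2+j : n ∸ suc (suc j) ≡ b
    n∸2+j = trans (cong (_∸ suc j) (ℕ.+-suc j b)) (ℕ.m+n∸m≡n j b)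
    numerator : ∀ X Y Z → suc b ℕ.* Z ≡ suc j ℕ.* X → n ℕ.* X ℕ.* Y ≡ (X ℕ.+ Z) ℕ.* Y ℕ.* suc b
    numerator X Y Z absorb = begin
      (suc j ℕ.+ suc b) ℕ.* X ℕ.* Y                   ≡⟨ solve (j ∷ b ∷ X ∷ Y ∷ []) ⟩
      X ℕ.* Y ℕ.* suc b ℕ.+ (suc j ℕ.* X) ℕ.* Y       ≡⟨ cong (λ u → X ℕ.* Y ℕ.* suc b ℕ.+ u ℕ.* Y) absorb ⟨
      X ℕ.* Y ℕ.* suc b ℕ.+ (suc b ℕ.* Z) ℕ.* Y       ≡⟨ solve (b ∷ X ∷ Y ∷ Z ∷ []) ⟩
      (X ℕ.+ Z) ℕ.* Y ℕ.* suc b                       ∎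

  -- For i ≥ n both sides vanish: frac reads division by n ∸ i = 0 as 0.
  JL-term : ∀ n k i → 2 ≤ n →
    frac (n ℕ.* ((n ∸ i) C i) ℕ.* (i C k)) (n ∸ i) ≡ fromℕ (lucas n i ℕ.* (i C k))
  JL-term (suc n) k zero _ = trans (cong (λ x → frac x (suc n)) (reorder n (0 C k))) (frac-cancel (1 ℕ.* (0 C k)) n)
    where
    reorder : ∀ n x → suc n ℕ.* 1 ℕ.* x ≡ 1 ℕ.* x ℕ.* suc n
    reorder = solve-∀
  JL-term n k (suc j) 2≤n with suc j ℕ.<? n
  ... | yes j<n = let b , 2+j+b≡n = ℕ.m≤n⇒∃[o]m+o≡n j<n in
    subst (λ n → frac (n ℕ.* ((n ∸ suc j) C suc j) ℕ.* (suc j C k)) (n ∸ suc j)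
                   ≡ fromℕ (lucas n (suc j) ℕ.* (suc j C k)))
          (trans (cong suc (ℕ.+-suc j b)) 2+j+b≡n) (absorbed-term j b k)
  ... | no  j≮n = begin
    frac (n ℕ.* ((n ∸ suc j) C suc j) ℕ.* (suc j C k)) (n ∸ suc j)
      ≡⟨ cong (frac _) (ℕ.m≤n⇒m∸n≡0 n≤1+j) ⟩
    0ℚ
      ≡⟨ fromℕ-0 ⟨
    fromℕ (0 ℕ.* (suc j C k))
      ≡⟨ cong (λ x → fromℕ (x ℕ.* (suc j C k))) (lucas-vanish n (suc j) 2≤n n/2<1+j) ⟨
    fromℕ (lucas n (suc j) ℕ.* (suc j C k))
    ∎
    where
    open ≡-Reasoning
    n≤1+j : n ≤ suc j
    n≤1+j = ℕ.≮⇒≥ j≮n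
    n/2<1+j : n ℕ./ 2 ℕ.< suc j
    n/2<1+j = ℕ.<-≤-trans (m/n<m n 2 {{ℕ.>-nonZero (ℕ.<-≤-trans ℕ.z<s 2≤n)}} (ℕ.n<1+n 1)) n≤1+j

  JL≡JLℕ : ∀ n k → 2 ≤ n → JL n k ≡ fromℕ (JLℕ n k)
  JL≡JLℕ n k 2≤n = trans
    (sumFromTo-fromℕ k (n ℕ./ 2) _ (λ t → lucas n t ℕ.* (t C k)) (λ t → JL-term n k t 2≤n))
    (cong fromℕ (sumFrom-extend k (n ℕ./ 2) (suc n) _ (ℕ.s≤s (m/n≤m n 2))
      (λ t t<k → trans (cong (lucas n t ℕ.*_) (k>n⇒nCk≡0 t<k)) (ℕ.*-zeroʳ (lucas n t)))
      (λ t n/2<t → cong (ℕ._* (t C k)) (lucas-vanish n t 2≤n n/2<t))))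

open import Data.Nat using (ℕ; _≤_; _+_; _*_)
open import Data.Rational using (0ℚ; _<_)

import Data.Nat as ℕ
import Data.Nat.Properties as ℕ
open import Data.Product using (_,_)
open import Data.List.Base using (_∷_; [])
open import Data.Nat.Tactic.RingSolver using (solve)
import Data.Rational as ℚ
import Data.Rational.Properties as ℚ
open import Data.Rational.Solver using (module +-*-Solver)
open import Relation.Binary.PropositionalEquality

open LucasSums using (JLℕ; double; double≡+)
open SecondDifference using (JLℕ-second-difference)
open RationalForm using (fromℕ; fromℕ-+; fromℕ-mono-<; JL≡JLℕ)

0<-difference : ∀ {p q} → p < q → 0ℚ < q ℚ.- p
0<-difference {p} {q} p<q = subst (_< q ℚ.- p) (ℚ.+-inverseʳ p) (ℚ.+-monoˡ-< (ℚ.- p) p<q)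

Φ≡fromℕ : ∀ n k → 2 ≤ n →
  Φ n k ≡ fromℕ (JLℕ (ℕ.suc n) (ℕ.suc k) + JLℕ n k) ℚ.- fromℕ (JLℕ (ℕ.suc n) k + JLℕ n (ℕ.suc k))
Φ≡fromℕ n k 2≤n = begin
    (JL (ℕ.suc n) (ℕ.suc k) ℚ.- JL (ℕ.suc n) k) ℚ.- (JL n (ℕ.suc k) ℚ.- JL n k)
  ≡⟨ cong₂ ℚ._-_ (cong₂ ℚ._-_ (JL≡JLℕ (ℕ.suc n) (ℕ.suc k) 2≤1+n) (JL≡JLℕ (ℕ.suc n) k 2≤1+n))
                 (cong₂ ℚ._-_ (JL≡JLℕ n (ℕ.suc k) 2≤n) (JL≡JLℕ n k 2≤n)) ⟩
    (fromℕ A ℚ.- fromℕ B) ℚ.- (fromℕ C ℚ.- fromℕ D)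
  ≡⟨ regroup (fromℕ A) (fromℕ B) (fromℕ C) (fromℕ D) ⟩
    (fromℕ A ℚ.+ fromℕ D) ℚ.- (fromℕ B ℚ.+ fromℕ C)
  ≡⟨ cong₂ ℚ._-_ (fromℕ-+ A D) (fromℕ-+ B C) ⟩
    fromℕ (A + D) ℚ.- fromℕ (B + C)
  ∎
  where
  open ≡-Reasoning
  A = JLℕ (ℕ.suc n) (ℕ.suc k)
  B = JLℕ (ℕ.suc n) k
  C = JLℕ n (ℕ.suc k)
  D = JLℕ n k
  2≤1+n : 2 ≤ ℕ.suc n
  2≤1+n = ℕ.m≤n⇒m≤1+n 2≤n
  regroup : ∀ a b c d → (a ℚ.- b) ℚ.- (c ℚ.- d) ≡ (a ℚ.+ d) ℚ.- (b ℚ.+ c)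
  regroup = +-*-Solver.solve 4 (λ a b c d → (a :- b) :- (c :- d) := (a :+ d) :- (b :+ c)) refl
    where open +-*-Solver using (_:-_; _:+_; _:=_)

lemma3p4 : (n k : ℕ) → 6 * k + 4 ≤ n → 0ℚ < Φ n k
lemma3p4 n k 6k+4≤n =
  let r , 6k+4+r≡n = ℕ.m≤n⇒∃[o]m+o≡n 6k+4≤n
      m = (4 + (4 * k + r)) + double k
  in subst (λ n → 0ℚ < Φ n k) (trans (shape k r) 6k+4+r≡n)
       (subst (0ℚ <_) (sym (Φ≡fromℕ m k (ℕ.s≤s (ℕ.s≤s ℕ.z≤n))))
         (0<-difference (fromℕ-mono-< (JLℕ-second-difference k r))))
  where
  shape : ∀ k r → (4 + (4 * k + r)) + double k ≡ 6 * k + 4 + r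
  shape k r = trans (cong ((4 + (4 * k + r)) +_) (double≡+ k)) (solve (k ∷ r ∷ []))
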